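{- Let $N$ be a cyclic group of square-free order, let $m\ge |N|$ and $k\ge 2$ be integers, let $T=\{\gamma_1,\dots,\gamma_k\}$ generate $N$, and let $h\in N$. Then one may choose a sequence $(j_i)_{i=1}^{m-1}$ of elements of $\{1,\dots,k\}$ and elements $\gamma_i^*\in\{\gamma_{j_i}^{\pm1}\}$ for each $i$, such that $\gamma_{i+1}^*=\gamma_i^*$ whenever $j_{i+1}=j_i$, and $\langle h\gamma_1^*\gamma_2^*\cdots\gamma_{m-1}^*\rangle$ contains $N^2$. Furthermore, if either (1) $|N|$ is odd, or (2) the elements of $T$ are not all in the same coset of $N^2$, then $\gamma_1^*,\dots,\gamma_{m-1}^*$ can be chosen (with the same constraints) so that $\langle h\gamma_1^*\cdots\gamma_{m-1}^*\rangle = N$.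
   Context: $N^2=\{y^2:y\in N\}$, the subgroup of squares of $N$. -}

module Defs where

open import Data.Nat as ℕ using (ℕ; zero; suc)
open import Data.Nat.Divisibility as ℕD using ()
open import Data.Nat.Primality using (Prime)
open import Data.Integer using (ℤ; _+_; _-_; _*_; -_; ∣_∣; +_)
open import Data.Fin using (Fin)
open import Data.Bool using (Bool; if_then_else_)
open import Data.Product using (Σ; ∃; _×_)
open import Relation.Nullary using (¬_)

-- The cyclic group N of order n is modelled as ℤ/nℤ (written additively):
-- elements are integers, equality in N is congruence modulo n.

SquareFree : ℕ → Set
SquareFree n = ∀ p → Prime p → ¬ ((p ℕ.* p) ℕD.∣ n)

_≡[_]_ : ℤ → ℕ → ℤ → Set
a ≡[ n ] b = n ℕD.∣ ∣ a - b ∣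

_∈⟨_⟩[_] : ℤ → ℤ → ℕ → Set
x ∈⟨ g ⟩[ n ] = ∃ λ (c : ℤ) → (c * g) ≡[ n ] x

-- x lies in N² = { y² : y ∈ N }  (additively: { y + y })
_∈Sq[_] : ℤ → ℕ → Set
x ∈Sq[ n ] = ∃ λ (y : ℤ) → (y + y) ≡[ n ] x

SqContainedIn : ℕ → ℤ → Set
SqContainedIn n g = ∀ x → x ∈Sq[ n ] → x ∈⟨ g ⟩[ n ]

GeneratesAll : ℕ → ℤ → Set
GeneratesAll n g = ∀ x → x ∈⟨ g ⟩[ n ]

sumFin : ∀ {k} → (Fin k → ℤ) → ℤ
sumFin {zero} f = + 0
sumFin {suc k} f = f Fin.zero + sumFin (λ i → f (Fin.suc i))
  where import Data.Fin as Fin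

GeneratedBy : ℕ → ∀ {k} → (Fin k → ℤ) → Set
GeneratedBy n {k} γ = ∀ (x : ℤ) → ∃ λ (c : Fin k → ℤ) → sumFin (λ j → c j * γ j) ≡[ n ] x

-- sum_{i < L} f i  (the product γ*_1 ⋯ γ*_L in additive notation, 0-indexed)
sumTo : ℕ → (ℕ → ℤ) → ℤ
sumTo zero f = + 0
sumTo (suc L) f = sumTo L f + f L

star : ∀ {k} → (Fin k → ℤ) → (ℕ → Fin k) → (ℕ → Bool) → ℕ → ℤ
star γ j s i = if s i then γ (j i) else - γ (j i)

-- an admissible choice (j_i, γ*_i), i = 0 … L-1 (paper's i = 1 … m-1, L = m-1):
-- γ*_{i+1} = γ*_i in N whenever j_{i+1} = j_i
Admissible : ℕ → ∀ {k} → (Fin k → ℤ) → ℕ → (ℕ → Fin k) → (ℕ → Bool) → Set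
Admissible n γ L j s =
  ∀ i → suc i ℕ.< L → j (suc i) ≡ j i → star γ j s (suc i) ≡[ n ] star γ j s i
  where open import Relation.Binary.PropositionalEquality using (_≡_)

word : ∀ {k} → (Fin k → ℤ) → ℤ → ℕ → (ℕ → Fin k) → (ℕ → Bool) → ℤ
word γ h L j s = h + sumTo L (star γ j s)

module Submission where

open import Defs
open import Data.Nat using (ℕ; _≤_; _∸_)
open import Data.Nat.Divisibility using (_∣_)
open import Data.Integer using (ℤ; _-_)
open import Data.Fin using (Fin)
open import Data.Bool using (Bool)
open import Data.Product using (Σ; ∃; _×_)
open import Data.Sum using (_⊎_)
open import Relation.Nullary using (¬_)
open import Function.Definitions using (Injective)
open import Relation.Binary.PropositionalEquality using (_≡_)

open import Data.Nat as ℕ using (zero; suc; s≤s; NonZero)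
import Data.Nat.Properties as ℕₚ
import Data.Nat.Divisibility as ℕ∣
open import Data.Nat.Primality using (prime[2])
open import Data.Integer as ℤ using (+_; -_; _+_; _*_; 0ℤ)
import Data.Integer.Properties as ℤₚ
import Data.Integer.Divisibility.Signed as ℤ∣
open import Data.Integer.DivMod using (_%_; _/_; a≡a%n+[a/n]*n; n%d<d)
open import Data.Integer.Tactic.RingSolver using (solve-∀)
open import Data.Fin as Fin using (toℕ; fromℕ<)
import Data.Fin.Properties as Finₚ
open import Data.Fin.Subset using (Subset; ⁅_⁆; _⊆_; _⊂_) renaming (_∈_ to _∈ₛ_; ∣_∣ to size)
import Data.Fin.Subset.Properties as Subsetₚ
open import Data.Vec using (tabulate)
import Data.Vec.Properties as Vecₚ
open import Data.List using (List; []; _∷_; _++_; length)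
import Data.List.Properties as Listₚ
open import Data.List.Relation.Unary.Linked using (Linked; []; [-]; _∷_)
open import Data.Bool using (true; false; if_then_else_; not)
import Data.Bool.Properties as Boolₚ
open import Data.Product using (_,_; proj₁; proj₂)
import Data.Product.Properties as Productₚ
open import Data.Sum using (inj₁; inj₂)
open import Data.Empty using (⊥-elim)
open import Function using (_∘_)
open import Relation.Nullary using (Dec; yes; no; does)
open import Relation.Nullary.Decidable using (dec-true; map′; _⊎-dec_; toWitnessFalse)
open import Relation.Unary using (Decidable)
open import Relation.Binary.Bundles using (Setoid)
open import Relation.Binary.Structures using (IsEquivalence)
import Relation.Binary.Reasoning.Setoid as SetoidReasoning
open import Relation.Binary.PropositionalEquality
  using (_≢_; refl; sym; trans; cong; cong₂; subst; subst₂; module ≡-Reasoning)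

-- Measuring letters against
-- γ₀ = γ_0, a word of length L has product (sum of its steps x − γ₀) + L·γ₀.
--  1. (ExactLengthSums) In a finite cyclic group, any sum of elements of a
--     finite set D ∋ 0 is a sum of exactly L elements of D once L ≥ n − 1.
--  2. (Words) Every word can be made admissible without changing its
--     length or product, by cancelling adjacent inverse pairs and padding
--     by conjugation; only a zero-product word of length 2 resists.
--  3. (Realisation, Targets) Hence x is the product of an admissible word
--     of length L whenever x − L·γ₀ lies in the subgroup K generated by
--     the steps.  K contains γ_j − γ₀ and 2γ₀; it is all of N when some
--     γ_j has an odd annihilator, which for square-free n fails only if
--     n is even and all γ_j are odd.
--  4. (Selection, Choices) Choosing the product ±1 (resp. ±2 in the
--     exceptional parity case) makes ⟨h γ*_1 ⋯ γ*_L⟩ equal to N (resp.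
--     contain N²).

module Congruence (n : ℕ) where

  infix 4 _≈_
  record _≈_ (a b : ℤ) : Set where
    constructor ≈-intro
    field divides : + n ℤ∣.∣ a - b
  open _≈_ public

  ≈-reflexive : ∀ {a b} → a ≡ b → a ≈ b
  ≈-reflexive {a} refl = ≈-intro (ℤ∣.divides 0ℤ (ℤₚ.+-inverseʳ a))

  ≈-refl : ∀ {a} → a ≈ a
  ≈-refl = ≈-reflexive refl

  ≈-sym : ∀ {a b} → a ≈ b → b ≈ a
  ≈-sym {a} {b} (≈-intro p) = ≈-intro (subst (+ n ℤ∣.∣_) (negate-diff a b) (ℤ∣.∣m⇒∣-m p))
    where negate-diff : ∀ a b → - (a - b) ≡ b - a
          negate-diff = solve-∀

  ≈-trans : ∀ {a b c} → a ≈ b → b ≈ c → a ≈ c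
  ≈-trans {a} {b} {c} (≈-intro p) (≈-intro q) =
    ≈-intro (subst (+ n ℤ∣.∣_) (telescope a b c) (ℤ∣.∣m∣n⇒∣m+n p q))
    where telescope : ∀ a b c → (a - b) + (b - c) ≡ a - c
          telescope = solve-∀

  isEquivalence : IsEquivalence _≈_
  isEquivalence = record { refl = ≈-refl ; sym = ≈-sym ; trans = ≈-trans }

  setoid : Setoid _ _
  setoid = record { isEquivalence = isEquivalence }

  module ≈-Reasoning = SetoidReasoning setoid

  +-cong : ∀ {a b c d} → a ≈ b → c ≈ d → a + c ≈ b + d
  +-cong {a} {b} {c} {d} (≈-intro p) (≈-intro q) =
    ≈-intro (subst (+ n ℤ∣.∣_) (regroup a b c d) (ℤ∣.∣m∣n⇒∣m+n p q))
    where regroup : ∀ a b c d → (a - b) + (c - d) ≡ (a + c) - (b + d)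
          regroup = solve-∀

  -‿cong : ∀ {a b} → a ≈ b → - a ≈ - b
  -‿cong {a} {b} (≈-intro p) = ≈-intro (subst (+ n ℤ∣.∣_) (negate-diff a b) (ℤ∣.∣m⇒∣-m p))
    where negate-diff : ∀ a b → - (a - b) ≡ (- a) - (- b)
          negate-diff = solve-∀

  +-congˡ : ∀ c {a b} → a ≈ b → c + a ≈ c + b
  +-congˡ c = +-cong (≈-refl {c})

  +-congʳ : ∀ c {a b} → a ≈ b → a + c ≈ b + c
  +-congʳ c p = +-cong p (≈-refl {c})

  *-congˡ : ∀ c {a b} → a ≈ b → c * a ≈ c * b
  *-congˡ c {a} {b} (≈-intro p) = ≈-intro (subst (+ n ℤ∣.∣_) (distrib c a b) (ℤ∣.∣n⇒∣m*n c p))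
    where distrib : ∀ c a b → c * (a - b) ≡ c * a - c * b
          distrib = solve-∀

  *-congʳ : ∀ c {a b} → a ≈ b → a * c ≈ b * c
  *-congʳ c {a} {b} p = subst₂ _≈_ (ℤₚ.*-comm c a) (ℤₚ.*-comm c b) (*-congˡ c p)

  divisible⇒≈0 : ∀ {a} → + n ℤ∣.∣ a → a ≈ 0ℤ
  divisible⇒≈0 {a} n∣a = ≈-intro (subst (+ n ℤ∣.∣_) (sym (ℤₚ.+-identityʳ a)) n∣a)

  _≈?_ : ∀ a b → Dec (a ≈ b)
  a ≈? b = map′ ≈-intro divides (+ n ℤ∣.∣? (a - b))

  toDefs : ∀ {a b} → a ≈ b → a ≡[ n ] b
  toDefs (≈-intro p) = ℤ∣.∣⇒∣ᵤ p

  fromDefs : ∀ {a b} → a ≡[ n ] b → a ≈ b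
  fromDefs p = ≈-intro (ℤ∣.∣ᵤ⇒∣ p)

-- Canonical representatives: every integer is congruent modulo n ≥ 1 to
-- exactly one element of Fin n.  This lets us treat subsets of N as
-- finite subsets (Data.Fin.Subset) and count them.

module Residue (n : ℕ) .{{_ : NonZero n}} where
  open Congruence n

  toℤ : Fin n → ℤ
  toℤ i = + toℕ i

  residue : ℤ → Fin n
  residue a = fromℕ< (n%d<d a (+ n))

  residue-≈ : ∀ a → toℤ (residue a) ≈ a
  residue-≈ a rewrite Finₚ.toℕ-fromℕ< (n%d<d a (+ n)) =
    ≈-intro (ℤ∣.divides (- (a / + n)) (remainder-eq (+ (a % + n)) (a / + n) a (a≡a%n+[a/n]*n a (+ n))))
    where remainder-eq : ∀ r q a → a ≡ r + q * + n → r - a ≡ (- q) * + n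
          remainder-eq r q a refl = cancel r q (+ n)
            where cancel : ∀ r q m → r - (r + q * m) ≡ (- q) * m
                  cancel = solve-∀

  small-multiple : ∀ {d} → n ℕ∣.∣ d → d ℕ.< n → d ≡ 0
  small-multiple {zero} _ _ = refl
  small-multiple {suc d} n∣d d<n = ⊥-elim (ℕₚ.<⇒≱ d<n (ℕ∣.∣⇒≤ n∣d))

  congruent-below : ∀ {u v} → u ℕ.≤ v → v ℕ.< n → + u ≈ + v → v ℕ.≤ u
  congruent-below {u} {v} u≤v v<n u≈v = ℕₚ.m∸n≡0⇒m≤n (small-multiple n∣v∸u v∸u<n)
    where
      n∣v∸u : n ℕ∣.∣ v ℕ.∸ u
      n∣v∸u = subst (n ℕ∣.∣_)
        (trans (cong ℤ.∣_∣ (ℤₚ.m-n≡m⊖n u v)) (ℤₚ.∣⊖∣-≤ u≤v)) (toDefs u≈v)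
      v∸u<n : v ℕ.∸ u ℕ.< n
      v∸u<n = ℕₚ.≤-<-trans (ℕₚ.m∸n≤m v u) v<n

  representative-unique : ∀ {u v} → u ℕ.< n → v ℕ.< n → + u ≈ + v → u ≡ v
  representative-unique {u} {v} u<n v<n u≈v with ℕₚ.≤-total u v
  ... | inj₁ u≤v = ℕₚ.≤-antisym u≤v (congruent-below u≤v v<n u≈v)
  ... | inj₂ v≤u = ℕₚ.≤-antisym (congruent-below v≤u u<n (≈-sym u≈v)) v≤u

  residue-cong : ∀ {a b} → a ≈ b → residue a ≡ residue b
  residue-cong {a} {b} a≈b = Finₚ.toℕ-injective
    (representative-unique (Finₚ.toℕ<n (residue a)) (Finₚ.toℕ<n (residue b))
      (≈-trans (residue-≈ a) (≈-trans a≈b (≈-sym (residue-≈ b)))))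

  residue-toℤ : ∀ i → residue (toℤ i) ≡ i
  residue-toℤ i = Finₚ.toℕ-injective
    (representative-unique (Finₚ.toℕ<n (residue (toℤ i))) (Finₚ.toℕ<n i) (residue-≈ (toℤ i)))

sumMap : {A : Set} → (A → ℤ) → List A → ℤ
sumMap f [] = 0ℤ
sumMap f (a ∷ w) = f a + sumMap f w

sumMap-++ : {A : Set} (f : A → ℤ) (u v : List A) → sumMap f (u ++ v) ≡ sumMap f u + sumMap f v
sumMap-++ f [] v = sym (ℤₚ.+-identityˡ (sumMap f v))
sumMap-++ f (a ∷ u) v = trans (cong (λ s → f a + s) (sumMap-++ f u v)) (sym (ℤₚ.+-assoc (f a) _ _))

sumMap-shift : {A : Set} (f : A → ℤ) (c : ℤ) (w : List A) →
  sumMap f w ≡ sumMap (λ a → f a - c) w + + length w * c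
sumMap-shift f c [] = refl
sumMap-shift f c (a ∷ w) = trans (cong (λ s → f a + s) (sumMap-shift f c w)) (regroup (f a) c _ (+ length w))
  where regroup : ∀ x c s l → x + (s + l * c) ≡ (x - c) + s + (+ 1 + l) * c
        regroup = solve-∀

sumTo-cons : ∀ L (f : ℕ → ℤ) → sumTo (suc L) f ≡ f 0 + sumTo L (λ i → f (suc i))
sumTo-cons zero f = ℤₚ.+-comm 0ℤ (f 0)
sumTo-cons (suc L) f = trans (cong (_+ f (suc L)) (sumTo-cons L f)) (ℤₚ.+-assoc (f 0) _ _)

sumFin-shift : ∀ {k} (c g : Fin k → ℤ) (g₀ : ℤ) →
  sumFin (λ i → c i * g i) ≡ sumFin (λ i → c i * (g i - g₀)) + sumFin c * g₀
sumFin-shift {zero} c g g₀ = sym (ℤₚ.+-identityˡ (0ℤ * g₀))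
sumFin-shift {suc k} c g g₀ =
  trans (cong (λ s → c Fin.zero * g Fin.zero + s) (sumFin-shift (λ i → c (Fin.suc i)) (λ i → g (Fin.suc i)) g₀))
        (regroup (c Fin.zero) (g Fin.zero) g₀ _ _)
  where regroup : ∀ c₀ x g₀ s t → c₀ * x + (s + t * g₀) ≡ c₀ * (x - g₀) + s + (c₀ + t) * g₀
        regroup = solve-∀

Even : ℤ → Set
Even z = + 2 ℤ∣.∣ z

Odd : ℤ → Set
Odd z = ∃ λ b → z ≡ b * + 2 + + 1

parity : ∀ z → Even z ⊎ Odd z
parity z with z % + 2 | n%d<d z (+ 2) | a≡a%n+[a/n]*n z (+ 2)
... | 0 | _ | z≡ = inj₁ (ℤ∣.divides (z / + 2) (trans z≡ (ℤₚ.+-identityˡ _)))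
... | 1 | _ | z≡ = inj₂ (z / + 2 , trans z≡ (ℤₚ.+-comm (+ 1) ((z / + 2) * + 2)))
... | suc (suc _) | s≤s (s≤s ()) | _

¬even⇒odd : ∀ {z} → ¬ Even z → Odd z
¬even⇒odd {z} ¬even with parity z
... | inj₁ even = ⊥-elim (¬even even)
... | inj₂ odd = odd

both-signs-even : ∀ t h l → Even (t - (h + l)) → Even (t - h - l) × Even (- t - h - l)
both-signs-even t h l even =
  subst Even (regroup₁ t h l) even ,
  subst Even (regroup₂ t h l) (ℤ∣.∣m∣n⇒∣m+n even (ℤ∣.divides (- t) refl))
  where regroup₁ : ∀ t h l → t - (h + l) ≡ t - h - l
        regroup₁ = solve-∀
        regroup₂ : ∀ t h l → t - (h + l) + - t * + 2 ≡ - t - h - l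
        regroup₂ = solve-∀

odd⇒1-even : ∀ {z} → Odd z → Even (+ 1 - z)
odd⇒1-even (b , refl) = ℤ∣.divides (- b) (cancel b)
  where cancel : ∀ b → + 1 - (b * + 2 + + 1) ≡ - b * + 2
        cancel = solve-∀

odd-combination : ∀ {k} (c g : Fin k → ℤ) → (∀ i → Odd (g i)) →
  Even (sumFin (λ i → c i * g i) - sumFin c)
odd-combination {zero} c g odd = ℤ∣.divides 0ℤ refl
odd-combination {suc k} c g odd with odd Fin.zero
... | b , g₀≡ = subst Even (regroup (c Fin.zero) (g Fin.zero) b _ _ g₀≡)
      (ℤ∣.∣m∣n⇒∣m+n (ℤ∣.∣n⇒∣m*n (c Fin.zero * b) ℤ∣.∣-refl)
                   (odd-combination (λ i → c (Fin.suc i)) (λ i → g (Fin.suc i)) (λ i → odd (Fin.suc i))))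
  where regroup : ∀ c₀ g₀ b s t → g₀ ≡ b * + 2 + + 1 →
                  c₀ * b * + 2 + (s - t) ≡ c₀ * g₀ + s - (c₀ + t)
        regroup c₀ g₀ b s t refl = ring c₀ b s t
          where ring : ∀ c₀ b s t → c₀ * b * + 2 + (s - t) ≡ c₀ * (b * + 2 + + 1) + s - (c₀ + t)
                ring = solve-∀

-- Let D = {δ a} be a finite family of elements
-- of ℤ/nℤ containing 0, and call y *generated* if it is a sum of steps.
-- Then every generated y is a sum of exactly L steps as soon as L ≥ n - 1.
-- Proof: the sets Sums r of sums of exactly r steps increase with r
-- (pad with the zero step); while they grow strictly, Sums r has at least
-- r + 1 elements, and once Sums r = Sums (r + 1) the set Sums r is closed
-- under adding steps, hence contains every generated element.

module ExactLengthSums (n : ℕ) .{{_ : NonZero n}} {A : Set} (δ : A → ℤ)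
    (search : ∀ {P : A → Set} → Decidable P → Dec (∃ P))
    (a₀ : A) (δa₀≈0 : Congruence._≈_ n (δ a₀) 0ℤ) where

  open Congruence n
  open Residue n

  -- y is generated: congruent to a sum of steps.  As N is finite, these
  -- elements form the subgroup generated by the steps.
  Generated : ℤ → Set
  Generated y = ∃ λ (w : List A) → sumMap δ w ≈ y

  generated-cong : ∀ {x y} → Generated x → x ≈ y → Generated y
  generated-cong (w , w≈x) x≈y = w , ≈-trans w≈x x≈y

  generated-step : ∀ a → Generated (δ a)
  generated-step a = a ∷ [] , ≈-reflexive (ℤₚ.+-identityʳ (δ a))

  generated-+ : ∀ {x y} → Generated x → Generated y → Generated (x + y)
  generated-+ (u , u≈x) (v , v≈y) =
    u ++ v , ≈-trans (≈-reflexive (sumMap-++ δ u v)) (+-cong u≈x v≈y)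

  generated-ℕ* : ∀ t {x} → Generated x → Generated (+ t * x)
  generated-ℕ* zero gx = [] , ≈-refl
  generated-ℕ* (suc t) {x} gx =
    generated-cong (generated-+ gx (generated-ℕ* t gx)) (≈-reflexive (unfold x (+ t)))
    where unfold : ∀ x t → x + t * x ≡ (+ 1 + t) * x
          unfold = solve-∀

  -- N is finite, so integer multiples reduce to natural ones
  generated-* : ∀ z {x} → Generated x → Generated (z * x)
  generated-* z {x} gx = generated-cong (generated-ℕ* (toℕ (residue z)) gx) (*-congʳ x (residue-≈ z))

  generated-combination : ∀ {k} (c g : Fin k → ℤ) → (∀ i → Generated (g i)) →
    Generated (sumFin (λ i → c i * g i))
  generated-combination {zero} c g gg = [] , ≈-refl
  generated-combination {suc k} c g gg =
    generated-+ (generated-* (c Fin.zero) (gg Fin.zero))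
                (generated-combination (λ i → c (Fin.suc i)) (λ i → g (Fin.suc i)) (λ i → gg (Fin.suc i)))

  -- Sums r: the residues of the sums of exactly r steps
  Sums : ℕ → Subset n
  Sums zero = ⁅ residue 0ℤ ⁆
  Sums (suc r) = tabulate λ i → does (search λ a → residue (toℤ i - δ a) Subsetₚ.∈? Sums r)

  Sums-suc⁺ : ∀ r i a → residue (toℤ i - δ a) ∈ₛ Sums r → i ∈ₛ Sums (suc r)
  Sums-suc⁺ r i a i-a∈ = Vecₚ.lookup⇒[]= i (Sums (suc r))
    (trans (Vecₚ.lookup∘tabulate _ i) (dec-true (search _) (a , i-a∈)))

  Sums-suc⁻ : ∀ r i → i ∈ₛ Sums (suc r) → ∃ λ a → residue (toℤ i - δ a) ∈ₛ Sums r
  Sums-suc⁻ r i i∈ = true⇒witness (search _) (trans (sym (Vecₚ.lookup∘tabulate _ i)) (Vecₚ.[]=⇒lookup i∈))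
    where true⇒witness : ∀ {P : Set} (d : Dec P) → does d ≡ true → P
          true⇒witness (yes p) _ = p

  Sums-sound : ∀ r {i} → i ∈ₛ Sums r → ∃ λ (w : List A) → length w ≡ r × sumMap δ w ≈ toℤ i
  Sums-sound zero {i} i∈ with Subsetₚ.x∈⁅y⁆⇒x≡y (residue 0ℤ) i∈
  ... | refl = [] , refl , ≈-sym (residue-≈ 0ℤ)
  Sums-sound (suc r) {i} i∈ with Sums-suc⁻ r i i∈
  ... | a , i-a∈ with Sums-sound r i-a∈
  ... | w , refl , w≈i-a = a ∷ w , refl , (begin
        δ a + sumMap δ w                   ≈⟨ +-congˡ (δ a) (≈-trans w≈i-a (residue-≈ _)) ⟩
        δ a + (toℤ i - δ a)                ≡⟨ cancel (δ a) (toℤ i) ⟩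
        toℤ i                              ∎)
    where open ≈-Reasoning
          cancel : ∀ d x → d + (x - d) ≡ x
          cancel = solve-∀

  Sums-step : ∀ r {i} a → i ∈ₛ Sums r → residue (toℤ i + δ a) ∈ₛ Sums (suc r)
  Sums-step r {i} a i∈ = Sums-suc⁺ r _ a (subst (_∈ₛ Sums r) (sym back-to-i) i∈)
    where
      back-to-i : residue (toℤ (residue (toℤ i + δ a)) - δ a) ≡ i
      back-to-i = trans (residue-cong (begin
          toℤ (residue (toℤ i + δ a)) - δ a   ≈⟨ +-congʳ (- δ a) (residue-≈ (toℤ i + δ a)) ⟩
          toℤ i + δ a - δ a                   ≡⟨ cancel (toℤ i) (δ a) ⟩
          toℤ i                               ∎)) (residue-toℤ i)
        where open ≈-Reasoning
              cancel : ∀ x d → x + d - d ≡ x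
              cancel = solve-∀

  -- the zero step makes the chain increasing
  Sums-mono : ∀ r → Sums r ⊆ Sums (suc r)
  Sums-mono r {i} i∈ = subst (_∈ₛ Sums (suc r)) i+0≡i (Sums-step r a₀ i∈)
    where i+0≡i : residue (toℤ i + δ a₀) ≡ i
          i+0≡i = trans (residue-cong (≈-trans (+-congˡ (toℤ i) δa₀≈0)
                                               (≈-reflexive (ℤₚ.+-identityʳ (toℤ i)))))
                        (residue-toℤ i)

  residue0∈Sums : ∀ r → residue 0ℤ ∈ₛ Sums r
  residue0∈Sums zero = Subsetₚ.x∈⁅x⁆ (residue 0ℤ)
  residue0∈Sums (suc r) = Sums-mono r (residue0∈Sums r)

  Closed : Subset n → Set
  Closed p = ∀ {i} → i ∈ₛ p → ∀ a → residue (toℤ i + δ a) ∈ₛ p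

  closed-contains-generated : ∀ {p} → Closed p → residue 0ℤ ∈ₛ p → ∀ {y} → Generated y → residue y ∈ₛ p
  closed-contains-generated {p} closed 0∈p (w , w≈y) = subst (_∈ₛ p) (residue-cong w≈y) (sums∈ w)
    where
      sums∈ : ∀ w → residue (sumMap δ w) ∈ₛ p
      sums∈ [] = 0∈p
      sums∈ (a ∷ w) = subst (_∈ₛ p) (residue-cong (begin
          toℤ (residue (sumMap δ w)) + δ a   ≈⟨ +-congʳ (δ a) (residue-≈ (sumMap δ w)) ⟩
          sumMap δ w + δ a                   ≡⟨ ℤₚ.+-comm (sumMap δ w) (δ a) ⟩
          δ a + sumMap δ w                   ∎)) (closed (sums∈ w) a)
        where open ≈-Reasoning

  stationary⇒closed : ∀ r → ¬ (Sums r ⊂ Sums (suc r)) → Closed (Sums r)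
  stationary⇒closed r no-growth {i} i∈ a with residue (toℤ i + δ a) Subsetₚ.∈? Sums r
  ... | yes i+a∈ = i+a∈
  ... | no i+a∉ = ⊥-elim (no-growth (Sums-mono r , _ , Sums-step r a i∈ , i+a∉))

  growth : ∀ r → suc r ℕ.≤ size (Sums r) ⊎ (∀ {y} → Generated y → residue y ∈ₛ Sums r)
  growth zero = inj₁ (ℕₚ.≤-reflexive (sym (Subsetₚ.∣⁅x⁆∣≡1 (residue 0ℤ))))
  growth (suc r) with growth r
  ... | inj₂ contains = inj₂ (Sums-mono r ∘ contains)
  ... | inj₁ large with Sums r Subsetₚ.⊂? Sums (suc r)
  ... | yes grows = inj₁ (ℕₚ.≤-<-trans large (Subsetₚ.p⊂q⇒∣p∣<∣q∣ grows))
  ... | no stays = inj₂ (Sums-mono r ∘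
          closed-contains-generated (stationary⇒closed r stays) (residue0∈Sums r))

  generated∈Sums : ∀ L → n ℕ.∸ 1 ℕ.≤ L → ∀ {y} → Generated y → residue y ∈ₛ Sums L
  generated∈Sums L n-1≤L {y} gy with growth L
  ... | inj₂ contains = contains gy
  ... | inj₁ large = subst (residue y ∈ₛ_) (sym (Subsetₚ.∣p∣≡n⇒p≡⊤ full)) Subsetₚ.∈⊤
    where full : size (Sums L) ≡ n
          full = ℕₚ.≤-antisym (Subsetₚ.∣p∣≤n (Sums L))
                   (ℕₚ.≤-trans (ℕₚ.m≤n+m∸n n 1) (ℕₚ.≤-trans (s≤s n-1≤L) large))

  exact-length : ∀ L → n ℕ.∸ 1 ℕ.≤ L → ∀ {y} → Generated y →
    ∃ λ (w : List A) → length w ≡ L × sumMap δ w ≈ y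
  exact-length L n-1≤L {y} gy with Sums-sound L (generated∈Sums L n-1≤L gy)
  ... | w , len , w≈y = w , len , ≈-trans w≈y (residue-≈ y)

module Words (n : ℕ) {k : ℕ} (γ : Fin k → ℤ) where
  open Congruence n

  Letter : Set
  Letter = Fin k × Bool

  value : Letter → ℤ
  value x = if proj₂ x then γ (proj₁ x) else - γ (proj₁ x)

  inverse : Letter → Letter
  inverse (j , b) = j , not b

  value-inverse : ∀ x → value (inverse x) ≡ - value x
  value-inverse (j , true) = refl
  value-inverse (j , false) = sym (ℤₚ.neg-involutive (γ j))

  sumW : List Letter → ℤ
  sumW = sumMap value

  Compatible : Letter → Letter → Set
  Compatible x y = proj₁ y ≡ proj₁ x → value y ≈ value x

  Admissible-word : List Letter → Set
  Admissible-word = Linked Compatible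

  incompatible⇒cancel : ∀ x y → proj₁ y ≡ proj₁ x → ¬ (value y ≈ value x) → value x + value y ≡ 0ℤ
  incompatible⇒cancel (j , true) (.j , true) refl y≉x = ⊥-elim (y≉x ≈-refl)
  incompatible⇒cancel (j , true) (.j , false) refl _ = ℤₚ.+-inverseʳ (γ j)
  incompatible⇒cancel (j , false) (.j , true) refl _ = ℤₚ.+-inverseˡ (γ j)
  incompatible⇒cancel (j , false) (.j , false) refl y≉x = ⊥-elim (y≉x ≈-refl)

  admissible-or-shorten : ∀ w → Admissible-word w ⊎
    ∃ λ w' → suc (suc (length w')) ≡ length w × sumW w' ≡ sumW w
  admissible-or-shorten [] = inj₁ []
  admissible-or-shorten (x ∷ []) = inj₁ [-]
  admissible-or-shorten (x ∷ y ∷ w) with admissible-or-shorten (y ∷ w)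
  ... | inj₂ (w' , len , sum) = inj₂ (x ∷ w' , cong suc len , cong (λ s → value x + s) sum)
  ... | inj₁ adm with proj₁ y Fin.≟ proj₁ x
  ... | no different = inj₁ ((λ same → ⊥-elim (different same)) ∷ adm)
  ... | yes same with value y ≈? value x
  ... | yes y≈x = inj₁ ((λ _ → y≈x) ∷ adm)
  ... | no y≉x = inj₂ (w , refl , sym (begin
          value x + (value y + sumW w)   ≡⟨ ℤₚ.+-assoc (value x) (value y) (sumW w) ⟨
          value x + value y + sumW w     ≡⟨ cong (_+ sumW w) (incompatible⇒cancel x y same y≉x) ⟩
          0ℤ + sumW w                    ≡⟨ ℤₚ.+-identityˡ (sumW w) ⟩
          sumW w                         ∎))
    where open ≡-Reasoning

  lastLetter : Letter → List Letter → Letter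
  lastLetter x [] = x
  lastLetter x (y ∷ w) = lastLetter y w

  admissible-snoc : ∀ x w y → Admissible-word (x ∷ w) → Compatible (lastLetter x w) y →
    Admissible-word (x ∷ w ++ y ∷ [])
  admissible-snoc x [] y _ compat = compat ∷ [-]
  admissible-snoc x (x′ ∷ w) y (c ∷ adm) compat = c ∷ admissible-snoc x′ w y adm compat

  conjugate : Letter → List Letter → List Letter
  conjugate x w = x ∷ w ++ inverse x ∷ []

  length-conjugate : ∀ x w → length (conjugate x w) ≡ suc (suc (length w))
  length-conjugate x w = cong suc (trans (Listₚ.length-++ w) (ℕₚ.+-comm (length w) 1))

  sum-conjugate : ∀ x w → sumW (conjugate x w) ≡ sumW w
  sum-conjugate x w = begin
    value x + sumW (w ++ inverse x ∷ [])      ≡⟨ cong (λ s → value x + s) (sumMap-++ value w _) ⟩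
    value x + (sumW w + (value (inverse x) + 0ℤ))
                                              ≡⟨ cong (λ v → value x + (sumW w + (v + 0ℤ))) (value-inverse x) ⟩
    value x + (sumW w + (- value x + 0ℤ))     ≡⟨ cancel (value x) (sumW w) ⟩
    sumW w                                    ∎
    where open ≡-Reasoning
          cancel : ∀ v s → v + (s + (- v + 0ℤ)) ≡ s
          cancel = solve-∀

  AdmissibleWord : ℕ → ℤ → Set
  AdmissibleWord r x = ∃ λ w → length w ≡ r × Admissible-word w × sumW w ≈ x

  module Padding (a₀ : Fin k) (other : Fin k → Fin k) (other-≢ : ∀ a → other a ≢ a) where

    same-index⇒inverse : ∀ x y → proj₁ y ≡ proj₁ x → y ≢ x → value (inverse x) ≡ value y
    same-index⇒inverse (j , true) (.j , true) refl y≢x = ⊥-elim (y≢x refl)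
    same-index⇒inverse (j , true) (.j , false) refl _ = refl
    same-index⇒inverse (j , false) (.j , true) refl _ = refl
    same-index⇒inverse (j , false) (.j , false) refl y≢x = ⊥-elim (y≢x refl)

    -- conjugate x ∷ w by x itself, unless the word ends with x, in which
    -- case conjugate by a letter of another index
    pad : ∀ x w → Admissible-word (x ∷ w) → AdmissibleWord (suc (suc (length (x ∷ w)))) (sumW (x ∷ w))
    pad x w adm with Productₚ.≡-dec Fin._≟_ Boolₚ._≟_ (lastLetter x w) x
    ... | yes last≡x = conjugate c (x ∷ w) , length-conjugate c (x ∷ w) ,
          (λ x∼c → ⊥-elim (other-≢ (proj₁ x) (sym x∼c))) ∷
            admissible-snoc x w (inverse c) adm
              (λ c∼last → ⊥-elim (other-≢ (proj₁ x) (trans c∼last (cong proj₁ last≡x)))) ,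
          ≈-reflexive (sum-conjugate c (x ∷ w))
      where c = other (proj₁ x) , true
    ... | no last≢x = conjugate x (x ∷ w) , length-conjugate x (x ∷ w) ,
          (λ _ → ≈-refl) ∷
            admissible-snoc x w (inverse x) adm
              (λ same → ≈-reflexive (same-index⇒inverse x (lastLetter x w) (sym same) last≢x)) ,
          ≈-reflexive (sum-conjugate x (x ∷ w))

    commutator : List Letter
    commutator = x ∷ y ∷ inverse x ∷ inverse y ∷ []
      where x = a₀ , true
            y = other a₀ , true

    commutator-admissible : Admissible-word commutator
    commutator-admissible = (λ e → ⊥-elim (other-≢ a₀ e)) ∷ (λ e → ⊥-elim (other-≢ a₀ (sym e)))
                          ∷ (λ e → ⊥-elim (other-≢ a₀ e)) ∷ [-]

    commutator-sum : sumW commutator ≡ 0ℤ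
    commutator-sum = vanish (γ a₀) (γ (other a₀))
      where vanish : ∀ a b → a + (b + (- a + (- b + 0ℤ))) ≡ 0ℤ
            vanish = solve-∀

    -- Any word of length r can be replaced by an admissible word of the same
    -- length and sum, except a word of length 2 with sum 0: cancel adjacent
    -- inverse pairs and restore the length by padding.
    normalise : ∀ r w → length w ≡ r → AdmissibleWord r (sumW w) ⊎ (r ≡ 2 × sumW w ≈ 0ℤ)
    normalise zero [] refl = inj₁ ([] , refl , [] , ≈-refl)
    normalise (suc zero) (x ∷ []) refl = inj₁ (x ∷ [] , refl , [-] , ≈-refl)
    normalise (suc (suc r)) w len with admissible-or-shorten w
    ... | inj₁ adm = inj₁ (w , len , adm , ≈-refl)
    ... | inj₂ (w' , len' , sum') =
          lengthen (normalise r w' (ℕₚ.suc-injective (ℕₚ.suc-injective (trans len' len))))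
      where
        lengthen : AdmissibleWord r (sumW w') ⊎ (r ≡ 2 × sumW w' ≈ 0ℤ) →
                   AdmissibleWord (suc (suc r)) (sumW w) ⊎ (suc (suc r) ≡ 2 × sumW w ≈ 0ℤ)
        lengthen (inj₁ ([] , refl , _ , v≈w')) = inj₂ (refl , ≈-sym (≈-trans v≈w' (≈-reflexive sum')))
        lengthen (inj₁ (x ∷ v , refl , adm , v≈w')) with pad x v adm
        ... | u , len-u , adm-u , u≈v =
              inj₁ (u , len-u , adm-u , ≈-trans u≈v (≈-trans v≈w' (≈-reflexive sum')))
        lengthen (inj₂ (refl , w'≈0)) =
          inj₁ (commutator , refl , commutator-admissible ,
                ≈-trans (≈-reflexive commutator-sum) (≈-sym (≈-trans (≈-reflexive (sym sum')) w'≈0)))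

  -- reading a word as a sequence indexed by ℕ (padded arbitrarily)
  letterAt : Letter → List Letter → ℕ → Letter
  letterAt d [] i = d
  letterAt d (x ∷ w) zero = x
  letterAt d (x ∷ w) (suc i) = letterAt d w i

  letterAt-compatible : ∀ d w → Admissible-word w → ∀ i → suc i ℕ.< length w →
    Compatible (letterAt d w i) (letterAt d w (suc i))
  letterAt-compatible d (x ∷ y ∷ w) (c ∷ adm) zero _ = c
  letterAt-compatible d (x ∷ y ∷ w) (c ∷ adm) (suc i) (s≤s i<) = letterAt-compatible d (y ∷ w) adm i i<
  letterAt-compatible d (x ∷ []) [-] i (s≤s ())

  sumTo-letterAt : ∀ d w → sumTo (length w) (λ i → value (letterAt d w i)) ≡ sumW w
  sumTo-letterAt d [] = refl
  sumTo-letterAt d (x ∷ w) =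
    trans (sumTo-cons (length w) _) (cong (λ s → value x + s) (sumTo-letterAt d w))

  toChoice : ∀ d w → Admissible-word w → ∃ λ (j : ℕ → Fin k) → ∃ λ (s : ℕ → Bool) →
    Admissible n γ (length w) j s × sumTo (length w) (star γ j s) ≡ sumW w
  toChoice d w adm = (λ i → proj₁ (letterAt d w i)) , (λ i → proj₂ (letterAt d w i)) ,
    (λ i i< same → toDefs (letterAt-compatible d w adm i i< same)) , sumTo-letterAt d w

  Choice : ℕ → ℤ → Set
  Choice L x = ∃ λ (j : ℕ → Fin k) → ∃ λ (s : ℕ → Bool) →
    Admissible n γ L j s × sumTo L (star γ j s) ≈ x

  ChoiceWith : ℕ → ℤ → (ℤ → Set) → Set
  ChoiceWith L h P = ∃ λ (j : ℕ → Fin k) → ∃ λ (s : ℕ → Bool) →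
    Admissible n γ L j s × P (word γ h L j s)

  map-choice : ∀ L h {P Q : ℤ → Set} → (∀ w → P w → Q w) → ChoiceWith L h P → ChoiceWith L h Q
  map-choice L h P⇒Q (j , s , adm , p) = j , s , adm , P⇒Q _ p

  admissibleWord⇒choice : ∀ d {L x} → AdmissibleWord L x → Choice L x
  admissibleWord⇒choice d (w , refl , adm , w≈x) with toChoice d w adm
  ... | j , s , adm-js , sum≡ = j , s , adm-js , ≈-trans (≈-reflexive sum≡) w≈x

-- Write γ₀ for the
-- first generator and measure every letter against it: the step of a
-- letter x is value x − γ₀, so that a word of length L has product
-- (sum of its steps) + L·γ₀, and the step of γ₀ itself is 0.  Hence x is
-- the product of an admissible word of any length L ≥ n − 1 as soon as
-- x − L·γ₀ lies in the subgroup K generated by the steps (apart from the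
-- degenerate case L = 2, x = 0, which needs n ∣ 2).

module Realisation (n : ℕ) .{{_ : NonZero n}} {k' : ℕ} (γ : Fin (suc (suc k')) → ℤ) where
  open Congruence n
  open Words n γ

  γ₀ : ℤ
  γ₀ = γ Fin.zero

  step : Letter → ℤ
  step x = value x - γ₀

  anyLetter? : ∀ {P : Letter → Set} → Decidable P → Dec (∃ P)
  anyLetter? P? = map′ fromIndex toIndex (Finₚ.any? λ j → P? (j , true) ⊎-dec P? (j , false))
    where
      fromIndex : ∃ (λ j → _ ⊎ _) → ∃ _
      fromIndex (j , inj₁ p) = (j , true) , p
      fromIndex (j , inj₂ p) = (j , false) , p
      toIndex : ∃ _ → ∃ (λ j → _ ⊎ _)
      toIndex ((j , true) , p) = j , inj₁ p
      toIndex ((j , false) , p) = j , inj₂ p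

  module K = ExactLengthSums n step anyLetter? (Fin.zero , true) (≈-reflexive (ℤₚ.+-inverseʳ γ₀))
  open K public using (Generated; generated-step; generated-cong; generated-+; generated-*; generated-combination)

  other : Fin (suc (suc k')) → Fin (suc (suc k'))
  other Fin.zero = Fin.suc Fin.zero
  other (Fin.suc _) = Fin.zero

  other-≢ : ∀ a → other a ≢ a
  other-≢ Fin.zero ()
  other-≢ (Fin.suc a) ()

  open Padding Fin.zero other other-≢

  square-of-γ₀ : ∀ {x} → n ∣ 2 → x ≈ 0ℤ → Choice 2 x
  square-of-γ₀ {x} n∣2 x≈0 = admissibleWord⇒choice d
    (d ∷ d ∷ [] , refl , (λ _ → ≈-refl) ∷ [-] , ≈-trans γ₀+γ₀≈0 (≈-sym x≈0))
    where
      d : Letter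
      d = Fin.zero , true
      γ₀+γ₀≈0 : γ₀ + (γ₀ + 0ℤ) ≈ 0ℤ
      γ₀+γ₀≈0 = divisible⇒≈0
        (subst (+ n ℤ∣.∣_) (double γ₀) (ℤ∣.∣m⇒∣m*n γ₀ (ℤ∣.∣ᵤ⇒∣ {+ n} {+ 2} n∣2)))
        where double : ∀ g → + 2 * g ≡ g + (g + 0ℤ)
              double = solve-∀

  sumW≈ : ∀ w {x} → sumMap step w ≈ x - + length w * γ₀ → sumW w ≈ x
  sumW≈ w {x} steps≈ = begin
    sumW w                                  ≡⟨ sumMap-shift value γ₀ w ⟩
    sumMap step w + + length w * γ₀         ≈⟨ +-congʳ (+ length w * γ₀) steps≈ ⟩
    x - + length w * γ₀ + + length w * γ₀   ≡⟨ cancel x (+ length w * γ₀) ⟩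
    x                                       ∎
    where open ≈-Reasoning
          cancel : ∀ x t → x - t + t ≡ x
          cancel = solve-∀

  realise : ∀ L → n ℕ.∸ 1 ℕ.≤ L → ∀ x → Generated (x - + L * γ₀) → (x ≈ 0ℤ → L ≡ 2 → n ∣ 2) →
    Choice L x
  realise L n-1≤L x gx degenerate with K.exact-length L n-1≤L gx
  ... | w , refl , steps≈ with normalise (length w) w refl
  ... | inj₁ (v , len , adm , v≈w) =
        admissibleWord⇒choice (Fin.zero , true) (v , len , adm , ≈-trans v≈w (sumW≈ w steps≈))
  ... | inj₂ (len≡2 , w≈0) =
        subst (λ L → Choice L x) (sym len≡2) (square-of-γ₀ (degenerate x≈0 len≡2) x≈0)
    where x≈0 : x ≈ 0ℤ
          x≈0 = ≈-trans (≈-sym (sumW≈ w steps≈)) w≈0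

-- It contains every γ_j − γ₀ and
-- 2γ₀, hence every Σ cᵢγᵢ − L·γ₀ with Σ cᵢ ≡ L (mod 2).  If some γ_j is
-- annihilated by an odd integer q, then K also contains γ₀, so K = N.

module Targets (n : ℕ) .{{_ : NonZero n}} {k' : ℕ} (γ : Fin (suc (suc k')) → ℤ)
    (generated-by-γ : GeneratedBy n γ) where
  open Congruence n
  open Realisation n γ

  -- the steps of γ_j and of γ₀⁻¹ give γ_j − γ₀ and 2γ₀
  γ-γ₀∈K : ∀ j → Generated (γ j - γ₀)
  γ-γ₀∈K j = generated-step (j , true)

  2γ₀∈K : Generated (γ₀ + γ₀)
  2γ₀∈K = generated-cong (generated-* (- + 1) (generated-step (Fin.zero , false))) (≈-reflexive (negate γ₀))
    where negate : ∀ g → - + 1 * (- g - g) ≡ g + g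
          negate = solve-∀

  -- x − L·γ₀ ∈ K when x = Σ cᵢγᵢ with Σ cᵢ ≡ L (mod 2):
  -- it equals Σ cᵢ(γᵢ − γ₀) + ((Σ cᵢ − L)/2)·2γ₀
  generated-if-coefficients-match : ∀ L x (c : Fin (suc (suc k')) → ℤ) →
    sumFin (λ i → c i * γ i) ≈ x → Even (sumFin c - + L) → Generated (x - + L * γ₀)
  generated-if-coefficients-match L x c cγ≈x (ℤ∣.divides b C-L≡) =
    generated-cong (generated-+ (generated-combination c (λ i → γ i - γ₀) γ-γ₀∈K) (generated-* b 2γ₀∈K)) (begin
      S + b * (γ₀ + γ₀)                      ≡⟨ double S b γ₀ ⟩
      S + b * + 2 * γ₀                       ≡⟨ cong (λ t → S + t * γ₀) C-L≡ ⟨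
      S + (C - + L) * γ₀                     ≡⟨ regroup S C (+ L) γ₀ ⟩
      S + C * γ₀ - + L * γ₀                  ≡⟨ cong (_- + L * γ₀) (sumFin-shift c γ γ₀) ⟨
      sumFin (λ i → c i * γ i) - + L * γ₀    ≈⟨ +-congʳ (- (+ L * γ₀)) cγ≈x ⟩
      x - + L * γ₀                           ∎)
    where
      open ≈-Reasoning
      S = sumFin (λ i → c i * (γ i - γ₀))
      C = sumFin c
      double : ∀ s b g → s + b * (g + g) ≡ s + b * + 2 * g
      double = solve-∀
      regroup : ∀ s c l g → s + (c - l) * g ≡ s + c * g - l * g
      regroup = solve-∀

  OddAnnihilator : Set
  OddAnnihilator = ∃ λ j → ∃ λ q → Odd q × q * γ j ≈ 0ℤ

  -- with q = 2b + 1 and q·γ_j ≡ 0:  γ₀ ≡ −q·(γ_j − γ₀) − b·2γ₀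
  γ₀∈K : OddAnnihilator → Generated γ₀
  γ₀∈K (j , q , (b , refl) , qγ≈0) =
    generated-cong (generated-+ (generated-* (- q) (γ-γ₀∈K j)) (generated-* (- b) 2γ₀∈K)) (begin
      - q * (γ j - γ₀) + - b * (γ₀ + γ₀)    ≡⟨ regroup b (γ j) γ₀ ⟩
      γ₀ + - (q * γ j)                      ≈⟨ +-congˡ γ₀ (-‿cong qγ≈0) ⟩
      γ₀ + - 0ℤ                             ≡⟨ ℤₚ.+-identityʳ γ₀ ⟩
      γ₀                                    ∎)
    where
      open ≈-Reasoning
      regroup : ∀ b g g₀ → - (b * + 2 + + 1) * (g - g₀) + - b * (g₀ + g₀) ≡ g₀ + - ((b * + 2 + + 1) * g)
      regroup = solve-∀

  -- then K contains every γ_j = (γ_j − γ₀) + γ₀, hence all of N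
  all-generated : OddAnnihilator → ∀ y → Generated y
  all-generated annihilator y with generated-by-γ y
  ... | c , cγ≡y = generated-cong (generated-combination c γ γ∈K) (fromDefs {sumFin (λ i → c i * γ i)} cγ≡y)
    where
      cancel : ∀ g g₀ → g - g₀ + g₀ ≡ g
      cancel = solve-∀
      γ∈K : ∀ j → Generated (γ j)
      γ∈K j = generated-cong (generated-+ (γ-γ₀∈K j) (γ₀∈K annihilator)) (≈-reflexive (cancel (γ j) γ₀))

  generated-if-parity : 2 ∣ n → (∀ j → Odd (γ j)) → ∀ L x → Even (x - + L) → Generated (x - + L * γ₀)
  generated-if-parity 2∣n odd L x x-L-even with generated-by-γ x
  ... | c , cγ≡x = generated-if-coefficients-match L x c S≈x
        (subst Even (regroup x (+ L) S C)
          (ℤ∣.∣m∣n⇒∣m-n (ℤ∣.∣m∣n⇒∣m+n x-L-even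
                                       (ℤ∣.∣-trans (ℤ∣.∣ᵤ⇒∣ {+ 2} {+ n} 2∣n) (divides S≈x)))
                        (odd-combination c γ odd)))
    where
      S = sumFin (λ i → c i * γ i)
      C = sumFin c
      S≈x : S ≈ x
      S≈x = fromDefs cγ≡x
      regroup : ∀ x l s c → x - l + (s - x) - (s - c) ≡ c - l
      regroup = solve-∀

  -- For square-free n: either some generator is annihilated by an odd
  -- integer, or n is even and all generators are odd.  (If n = 2h and some
  -- γ_j = 2w is even, then h is odd and h·γ_j = w·n ≡ 0.)
  annihilator-or-odd : SquareFree n → OddAnnihilator ⊎ (2 ∣ n × ∀ j → Odd (γ j))
  annihilator-or-odd square-free with 2 ℕ∣.∣? n
  ... | no 2∤n = inj₁ (Fin.zero , + n , ¬even⇒odd (2∤n ∘ ℤ∣.∣⇒∣ᵤ) ,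
                       divisible⇒≈0 (ℤ∣.∣m⇒∣m*n γ₀ (ℤ∣.∣-refl {+ n})))
  ... | yes 2∣n with Finₚ.any? (λ j → + 2 ℤ∣.∣? γ j)
  ... | no none-even = inj₂ (2∣n , λ j → ¬even⇒odd (λ even → none-even (j , even)))
  ... | yes (j , ℤ∣.divides w γj≡) with 2∣n
  ... | ℕ∣.divides h n≡h*2 = inj₁ (j , + h , ¬even⇒odd h-not-even , divisible⇒≈0 (ℤ∣.divides w (begin
          + h * γ j               ≡⟨ cong (+ h *_) γj≡ ⟩
          + h * (w * + 2)         ≡⟨ reassociate (+ h) w ⟩
          w * (+ h * + 2)         ≡⟨ cong (w *_) (ℤₚ.pos-* h 2) ⟨
          w * + (h ℕ.* 2)         ≡⟨ cong (λ m → w * + m) n≡h*2 ⟨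
          w * + n                 ∎)))
    where
      open ≡-Reasoning
      reassociate : ∀ h w → h * (w * + 2) ≡ w * (h * + 2)
      reassociate = solve-∀
      h-not-even : ¬ Even (+ h)
      h-not-even even = square-free 2 prime[2]
        (subst (2 ℕ.* 2 ℕ∣.∣_) (sym n≡h*2) (ℕ∣.*-monoˡ-∣ 2 (ℤ∣.∣⇒∣ᵤ even)))

-- Producing h γ*_1 ⋯ γ*_L ≡ ±t: aim at t − h, unless t − h ≡ 0 (which
-- might be the degenerate target of realise); then aim at −t − h.

module Selection (n : ℕ) .{{_ : NonZero n}} {k' : ℕ} (γ : Fin (suc (suc k')) → ℤ) where
  open Congruence n
  open Words n γ using (Choice; ChoiceWith; map-choice)
  open Realisation n γ

  prefix : ∀ L h u → Choice L (u - h) → ChoiceWith L h (_≈ u)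
  prefix L h u (j , s , adm , sum≈) = j , s , adm , (begin
    h + sumTo L (star γ j s)    ≈⟨ +-congˡ h sum≈ ⟩
    h + (u - h)                 ≡⟨ cancel h u ⟩
    u                           ∎)
    where open ≈-Reasoning
          cancel : ∀ h u → h + (u - h) ≡ u
          cancel = solve-∀

  both-vanish⇒2t≈0 : ∀ h t → t - h ≈ 0ℤ → - t - h ≈ 0ℤ → t + t ≈ 0ℤ
  both-vanish⇒2t≈0 h t t-h≈0 -t-h≈0 = begin
    t + t                      ≡⟨ difference t h ⟩
    (t - h) - (- t - h)        ≈⟨ +-cong t-h≈0 (-‿cong -t-h≈0) ⟩
    0ℤ                         ∎
    where open ≈-Reasoning
          difference : ∀ t h → t + t ≡ (t - h) - (- t - h)
          difference = solve-∀

  select : ∀ L → n ℕ.∸ 1 ℕ.≤ L → ∀ h t → Generated (t - h - + L * γ₀) → Generated (- t - h - + L * γ₀) →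
    (t + t ≈ 0ℤ → L ≡ 2 → n ∣ 2) → ChoiceWith L h (λ w → w ≈ t ⊎ w ≈ - t)
  select L n-1≤L h t g₊ g₋ degenerate with (t - h) ≈? 0ℤ
  ... | no t-h≉0 = map-choice L h {P = _≈ t} (λ w → inj₁ {B = w ≈ - t})
        (prefix L h t (realise L n-1≤L (t - h) g₊ (λ t-h≈0 _ → ⊥-elim (t-h≉0 t-h≈0))))
  ... | yes t-h≈0 = map-choice L h {P = _≈ - t} (λ w → inj₂ {A = w ≈ t})
        (prefix L h (- t) (realise L n-1≤L (- t - h) g₋ (degenerate ∘ both-vanish⇒2t≈0 h t t-h≈0)))

module Generation (n : ℕ) where
  open Congruence n

  ±-multiples : ∀ {w t} → w ≈ t ⊎ w ≈ - t → ∀ c → (c * t) ∈⟨ w ⟩[ n ]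
  ±-multiples (inj₁ w≈t) c = c , toDefs (*-congˡ c w≈t)
  ±-multiples {w} {t} (inj₂ w≈-t) c =
    - c , toDefs (≈-trans (*-congˡ (- c) w≈-t) (≈-reflexive (signs c t)))
    where signs : ∀ c t → - c * - t ≡ c * t
          signs = solve-∀

  ±1-generates : ∀ {w} → w ≈ + 1 ⊎ w ≈ - + 1 → GeneratesAll n w
  ±1-generates {w} ±1 x = subst (_∈⟨ w ⟩[ n ]) (ℤₚ.*-identityʳ x) (±-multiples ±1 x)

  generates-all⇒squares : ∀ {w} → GeneratesAll n w → SqContainedIn n w
  generates-all⇒squares generates x _ = generates x

  ±2-contains-squares : ∀ {w} → w ≈ + 2 ⊎ w ≈ - + 2 → SqContainedIn n w
  ±2-contains-squares {w} ±2 x (y , y+y≡x) with ±-multiples ±2 y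
  ... | c , cw≡2y = c , toDefs (≈-trans (fromDefs {c * w} cw≡2y)
                                 (≈-trans (≈-reflexive (double y)) (fromDefs {y + y} y+y≡x)))
    where double : ∀ y → y * + 2 ≡ y + y
          double = solve-∀

odd-differences-are-squares : ∀ n {k} (γ : Fin k → ℤ) → (∀ j → Odd (γ j)) → ∀ a b → (γ a - γ b) ∈Sq[ n ]
odd-differences-are-squares n γ odd a b with odd a | odd b
... | p , γa≡ | q , γb≡ = p - q , toDefs (≈-reflexive (begin
      (p - q) + (p - q)                        ≡⟨ regroup p q ⟩
      (p * + 2 + + 1) - (q * + 2 + + 1)        ≡⟨ cong₂ _-_ γa≡ γb≡ ⟨
      γ a - γ b                                ∎))
  where open Congruence n
        open ≡-Reasoning
        regroup : ∀ p q → (p - q) + (p - q) ≡ (p * + 2 + + 1) - (q * + 2 + + 1)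
        regroup = solve-∀

small-even-divides-two : ∀ n .{{_ : NonZero n}} → 2 ∣ n → n ℕ.∸ 1 ℕ.≤ 2 → n ∣ 2
small-even-divides-two 1 2∣1 _ = ⊥-elim (toWitnessFalse {a? = 2 ℕ∣.∣? 1} _ 2∣1)
small-even-divides-two 2 _ _ = ℕ∣.∣-refl
small-even-divides-two 3 2∣3 _ = ⊥-elim (toWitnessFalse {a? = 2 ℕ∣.∣? 3} _ 2∣3)
small-even-divides-two (suc (suc (suc (suc _)))) _ (s≤s (s≤s ()))

module Choices (n : ℕ) .{{_ : NonZero n}} {k' : ℕ} (γ : Fin (suc (suc k')) → ℤ)
    (generated-by-γ : GeneratedBy n γ) where
  open Congruence n
  open Generation n
  open Words n γ using (ChoiceWith; map-choice)
  open Targets n γ generated-by-γ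
  open Selection n γ

  -- if K = N, aim at ±1
  generating-choice : OddAnnihilator → ∀ L → n ℕ.∸ 1 ℕ.≤ L → ∀ h → ChoiceWith L h (GeneratesAll n)
  generating-choice annihilator L n-1≤L h = map-choice L h (λ w → ±1-generates {w})
    (select L n-1≤L h (+ 1) (all-generated annihilator _) (all-generated annihilator _) (λ 2≈0 _ → toDefs 2≈0))

  parity-choice : 2 ∣ n → (∀ j → Odd (γ j)) → ∀ L → n ℕ.∸ 1 ℕ.≤ L → ∀ h t → Even (t - (h + + L)) →
    (t + t ≈ 0ℤ → L ≡ 2 → n ∣ 2) → ChoiceWith L h (λ w → w ≈ t ⊎ w ≈ - t)
  parity-choice 2∣n odd L n-1≤L h t even =
    select L n-1≤L h t (generated-if-parity 2∣n odd L (t - h) (proj₁ signs))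
                       (generated-if-parity 2∣n odd L (- t - h) (proj₂ signs))
    where signs = both-signs-even t h (+ L) even

  squares-choice : 2 ∣ n → (∀ j → Odd (γ j)) → ∀ L → n ℕ.∸ 1 ℕ.≤ L → ∀ h → ChoiceWith L h (SqContainedIn n)
  squares-choice 2∣n odd L n-1≤L h with parity (h + + L)
  ... | inj₁ even = map-choice L h (λ w → ±2-contains-squares {w})
        (parity-choice 2∣n odd L n-1≤L h (+ 2) (ℤ∣.∣m∣n⇒∣m-n ℤ∣.∣-refl even)
          (λ _ L≡2 → small-even-divides-two n 2∣n (subst (n ℕ.∸ 1 ℕ.≤_) L≡2 n-1≤L)))
  ... | inj₂ odd′ = map-choice L h (λ w ±1 → generates-all⇒squares {w} (±1-generates ±1))
        (parity-choice 2∣n odd L n-1≤L h (+ 1) (odd⇒1-even odd′) (λ 2≈0 _ → toDefs 2≈0))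

-- Either some generator has an odd annihilator, and the
-- word can be made ≡ ±1; or n is even and all generators are odd, which
-- part two excludes (the generators then lie in one coset of N²) and
-- which part one handles by squares-choice.

lemma3p9 : (n : ℕ) → 1 ≤ n → SquareFree n →
    (m k : ℕ) → n ≤ m → 2 ≤ k →
    (γ : Fin k → ℤ) → Injective _≡_ (λ a b → a ≡[ n ] b) γ → GeneratedBy n γ →
    (h : ℤ) →
    (∃ λ (j : ℕ → Fin k) → ∃ λ (s : ℕ → Bool) →
        Admissible n γ (m ∸ 1) j s × SqContainedIn n (word γ h (m ∸ 1) j s))
    × ((¬ (2 ∣ n) ⊎ ¬ (∀ a b → (γ a - γ b) ∈Sq[ n ])) →
       ∃ λ (j : ℕ → Fin k) → ∃ λ (s : ℕ → Bool) →
        Admissible n γ (m ∸ 1) j s × GeneratesAll n (word γ h (m ∸ 1) j s))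
lemma3p9 n@(suc _) _ square-free m (suc (suc k')) n≤m (s≤s (s≤s _)) γ _ generated-by-γ h =
  contains-squares , generates-all
  where
    open Generation n using (generates-all⇒squares)
    open Words n γ using (ChoiceWith; map-choice)
    open Targets n γ generated-by-γ using (annihilator-or-odd)
    open Choices n γ generated-by-γ

    L : ℕ
    L = m ∸ 1

    n-1≤L : n ∸ 1 ≤ L
    n-1≤L = ℕₚ.∸-monoˡ-≤ 1 n≤m

    contains-squares : ChoiceWith L h (SqContainedIn n)
    contains-squares with annihilator-or-odd square-free
    ... | inj₁ annihilator =
          map-choice L h (λ w → generates-all⇒squares {w}) (generating-choice annihilator L n-1≤L h)
    ... | inj₂ (2∣n , odd) = squares-choice 2∣n odd L n-1≤L h

    generates-all : (¬ (2 ∣ n) ⊎ ¬ (∀ a b → (γ a - γ b) ∈Sq[ n ])) → ChoiceWith L h (GeneratesAll n)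
    generates-all hypothesis with annihilator-or-odd square-free | hypothesis
    ... | inj₁ annihilator | _ = generating-choice annihilator L n-1≤L h
    ... | inj₂ (2∣n , _) | inj₁ 2∤n = ⊥-elim (2∤n 2∣n)
    ... | inj₂ (_ , odd) | inj₂ not-all-squares = ⊥-elim (not-all-squares (odd-differences-are-squares n γ odd))
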